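{- Let $q=p^m$ with $p$ prime and $m>2$, and let $A,B$ be $\mathbb{F}_p$-subspaces of $\mathbb{F}_q$ of codimension $1$. Then $\langle A\cdot A\rangle_{\mathbb{F}_p}=\langle A\cdot B\rangle_{\mathbb{F}_p}=\mathbb{F}_q$.
   Context: For subsets $X,Y\subseteq\mathbb{F}_q$, $X\cdot Y=\{xy:x\in X,y\in Y\}$, and $\langle X\rangle_{\mathbb{F}_p}$ is the $\mathbb{F}_p$-span of $X$. -}

module Defs where

open import Level using (Level; _⊔_)
open import Algebra.Bundles using (CommutativeRing)
open import Data.Nat as ℕ using (ℕ; zero; suc)
open import Data.Fin using (Fin)
open import Data.List using (List; []; _∷_; length)
open import Data.List.Relation.Unary.All using (All)
open import Data.Product using (Σ; ∃; _×_; _,_; proj₁; proj₂)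
open import Relation.Nullary using (¬_)
open import Relation.Binary.PropositionalEquality using (_≡_)
import Data.List.Membership.Setoid as SetoidMembership
import Data.List.Relation.Unary.Unique.Setoid as SetoidUnique
import Algebra.Definitions.RawMonoid as RawMonoidDefs

record FiniteField (c ℓ : Level) : Set (Level.suc (c ⊔ ℓ)) where
  field
    commRing : CommutativeRing c ℓ
  open CommutativeRing commRing public
  open SetoidMembership setoid using (_∈_)
  open SetoidUnique setoid using (Unique)
  field
    1≉0      : ¬ (1# ≈ 0#)
    inverse  : ∀ x → ¬ (x ≈ 0#) → Σ Carrier λ y → x * y ≈ 1#
    elems    : List Carrier
    complete : ∀ x → x ∈ elems
    unique   : Unique elems

  card : ℕ
  card = length elems

module _ {c ℓ : Level} (F : FiniteField c ℓ) where
  open FiniteField F using (Carrier; _≈_; _+_; _*_; 0#; +-rawMonoid)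

  -- n × x = x + ... + x (n times): the action of the prime field
  -- (integers mod the characteristic) on F.
  open RawMonoidDefs +-rawMonoid using () renaming (_×_ to _·ₙ_) public

  sumFin : ∀ d → (Fin d → Carrier) → Carrier
  sumFin zero    f = 0#
  sumFin (suc d) f = f Fin.zero + sumFin d (λ i → f (Fin.suc i))

  record IsFpSubspace {a : Level} (A : Carrier → Set a) : Set (c ⊔ ℓ ⊔ a) where
    field
      resp   : ∀ {x y} → x ≈ y → A x → A y
      zero∈  : A 0#
      +-closed : ∀ {x y} → A x → A y → A (x + y)
      ·-closed : ∀ (n : ℕ) {x} → A x → A (n ·ₙ x)

  record IsFpBasis {a : Level} (p : ℕ) (A : Carrier → Set a) (d : ℕ)
                   (v : Fin d → Carrier) : Set (c ⊔ ℓ ⊔ a) where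
    field
      inA        : ∀ i → A (v i)
      independent : ∀ (k : Fin d → ℕ) → (∀ i → k i ℕ.< p) →
                    sumFin d (λ i → k i ·ₙ v i) ≈ 0# → ∀ i → k i ≡ 0
      spanning   : ∀ x → A x → Σ (Fin d → ℕ) λ k → x ≈ sumFin d (λ i → k i ·ₙ v i)

  HasFpDim : {a : Level} → ℕ → (Carrier → Set a) → ℕ → Set (c ⊔ ℓ ⊔ a)
  HasFpDim p A d = Σ (Fin d → Carrier) (IsFpBasis p A d)

  _·ₛ_ : {a b : Level} → (Carrier → Set a) → (Carrier → Set b) → Carrier → Set (c ⊔ ℓ ⊔ a ⊔ b)
  (X ·ₛ Y) z = Σ Carrier λ x → Σ Carrier λ y → X x × Y y × (z ≈ x * y)

  lincomb : List (ℕ × Carrier) → Carrier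
  lincomb []             = 0#
  lincomb ((n , y) ∷ ts) = (n ·ₙ y) + lincomb ts

  Span : {a : Level} → (Carrier → Set a) → Carrier → Set (c ⊔ ℓ ⊔ a)
  Span X z = Σ (List (ℕ × Carrier)) λ ts → All (λ t → X (proj₂ t)) ts × (z ≈ lincomb ts)

-- Let n = m − 1, fix bases a and b of A and B and a nonzero a₀ ∈ A. If some product aᵢ bⱼ
-- lies outside the hyperplane a₀B, then a₀B together with aᵢ bⱼ spans F_q, and all of these
-- vectors lie in A·B. Otherwise the hyperplane C = a₀⁻¹A satisfies C·B ⊆ B, i.e. C lies in the
-- stabiliser K = {x | xB ⊆ B}, which is closed under sums, products and nonzero inverses.
-- As B ≠ F_q there is some y ∉ K; then y ∉ C, so F_q = C ⊕ F_p y, and since |C| = p^n > p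
-- two distinct c, c′ ∈ C give multiples yc, yc′ with the same y-coordinate. Hence
-- y(c − c′) ∈ C ⊆ K with 0 ≠ c − c′ ∈ K, so y ∈ K: a contradiction.
module Submission where

open import Defs
open import Level using (_⊔_)
open import Data.Nat as ℕ using (ℕ; zero; suc; pred; _^_; _∸_; _>_; _≤_; _<_; z≤n; z<s; s≤s; NonZero)
import Data.Nat.Properties as ℕ
open import Data.Nat.Properties using (suc-pred)
open import Data.Nat.DivMod using (_%_; _/_; m≡m%n+[m/n]*n; m%n<n)
open import Data.Nat.GCD using (module Bézout)
open import Data.Nat.Coprimality using (Coprime; coprime-Bézout; prime⇒coprime)
open import Data.Nat.Primality using (Prime; prime⇒nonZero; prime⇒nonTrivial)
open import Data.Fin as Fin using (Fin; toℕ)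
import Data.Fin.Properties as Fin
open import Data.Fin.Permutation using (Permutation; permutation)
open import Data.Vec.Functional using (Vector; []; _∷_; map)
import Data.List as List
open import Data.List using (lookup)
import Data.List.Relation.Unary.All as All
import Data.List.Relation.Unary.Any as Any
import Data.List.Relation.Unary.Any.Properties as Any
open import Data.List.Relation.Unary.AllPairs as AllPairs using (AllPairs)
open import Data.List.Membership.Propositional.Properties using (∈-lookup)
open import Data.Product using (∃; _×_; _,_; proj₁; proj₂)
open import Function using (_∘_; Injective)
open import Relation.Binary using (Decidable)
open import Relation.Binary.PropositionalEquality using (_≡_)
import Relation.Binary.PropositionalEquality as ≡
open import Relation.Nullary using (¬_; Dec; yes; no)
import Relation.Nullary.Decidable as Dec
open import Relation.Nullary.Negation using (contradiction)
import Algebra.Properties.Monoid.Mult as MonoidMult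
import Algebra.Properties.CommutativeMonoid.Mult as CommutativeMonoidMult
import Algebra.Properties.Semiring.Mult as SemiringMult
import Algebra.Properties.Semiring.Sum as SemiringSum
import Algebra.Properties.Group as GroupProperties
import Algebra.Properties.AbelianGroup as AbelianGroupProperties
import Algebra.Properties.Ring as RingProperties
import Algebra.Properties.CommutativeSemigroup as CommutativeSemigroupProperties

module FiniteFieldTheory {c ℓ} (F : FiniteField c ℓ) where
  open FiniteField F
  open import Relation.Binary.Reasoning.Setoid setoid

  enum : Fin card → Carrier
  enum = lookup elems

  index : Carrier → Fin card
  index x = Any.index (complete x)

  ≈enum-index : ∀ x → x ≈ enum (index x)
  ≈enum-index x = Any.lookup-index (complete x)

  enum-injective : Injective _≡_ _≈_ enum
  enum-injective = lookup-injective unique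
    where
    lookup-injective : ∀ {xs} → AllPairs (λ x y → ¬ x ≈ y) xs → Injective _≡_ _≈_ (lookup xs)
    lookup-injective (_ AllPairs.∷ _)    {Fin.zero}  {Fin.zero}  _ = ≡.refl
    lookup-injective (x≉ AllPairs.∷ _)   {Fin.zero}  {Fin.suc j} e = contradiction e (All.lookup x≉ (∈-lookup j))
    lookup-injective (x≉ AllPairs.∷ _)   {Fin.suc i} {Fin.zero}  e = contradiction (sym e) (All.lookup x≉ (∈-lookup i))
    lookup-injective (_ AllPairs.∷ xs≉)  {Fin.suc i} {Fin.suc j} e = ≡.cong Fin.suc (lookup-injective xs≉ e)

  infix 4 _≈?_
  _≈?_ : Decidable _≈_
  x ≈? y with index x Fin.≟ index y
  ... | yes i≡j = yes (begin
    x               ≈⟨ ≈enum-index x ⟩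
    enum (index x)  ≡⟨ ≡.cong enum i≡j ⟩
    enum (index y)  ≈⟨ ≈enum-index y ⟨
    y               ∎)
  ... | no i≢j = no λ x≈y → i≢j (enum-injective (begin
    enum (index x)  ≈⟨ ≈enum-index x ⟨
    x               ≈⟨ x≈y ⟩
    y               ≈⟨ ≈enum-index y ⟩
    enum (index y)  ∎))

  infix 4 _∈img_
  _∈img_ : ∀ {n} → Carrier → (Fin n → Carrier) → Set ℓ
  x ∈img g = ∃ λ j → x ≈ g j

  infix 4 _∈img?_
  _∈img?_ : ∀ {n} x (g : Fin n → Carrier) → Dec (x ∈img g)
  x ∈img? g = Fin.any? (λ j → x ≈? g j)

  injective⇒≤ : ∀ {m n} {f : Fin n → Carrier} {g : Fin m → Carrier} →
                Injective _≡_ _≈_ f → (∀ i → f i ∈img g) → n ≤ m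
  injective⇒≤ {f = f} {g} f-inj f⊆g = Fin.injective⇒≤ λ {i} {j} e → f-inj (begin
    f i                  ≈⟨ proj₂ (f⊆g i) ⟩
    g (proj₁ (f⊆g i))    ≡⟨ ≡.cong g e ⟩
    g (proj₁ (f⊆g j))    ≈⟨ proj₂ (f⊆g j) ⟨
    f j                  ∎)

  injective⇒onto : ∀ {m n} {f : Fin n → Carrier} {g : Fin m → Carrier} →
                   m ≤ n → Injective _≡_ _≈_ f → (∀ i → f i ∈img g) → ∀ j → g j ∈img f
  injective⇒onto {n = n} {f} {g} m≤n f-inj f⊆g j with g j ∈img? f
  ... | yes gj∈f = gj∈f
  ... | no  gj∉f = contradiction (injective⇒≤ f′-inj f′⊆g) (ℕ.<⇒≱ (s≤s m≤n))
    where
    f′ : Fin (suc n) → Carrier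
    f′ = g j ∷ f
    f′-inj : Injective _≡_ _≈_ f′
    f′-inj {Fin.zero}  {Fin.zero}  _ = ≡.refl
    f′-inj {Fin.zero}  {Fin.suc i} e = contradiction (i , e) gj∉f
    f′-inj {Fin.suc i} {Fin.zero}  e = contradiction (i , sym e) gj∉f
    f′-inj {Fin.suc i} {Fin.suc k} e = ≡.cong Fin.suc (f-inj e)
    f′⊆g : ∀ i → f′ i ∈img g
    f′⊆g Fin.zero    = j , refl
    f′⊆g (Fin.suc i) = f⊆g i

  injective⇒surjective : ∀ {n} {f : Fin n → Carrier} → card ≤ n → Injective _≡_ _≈_ f → ∀ x → x ∈img f
  injective⇒surjective {f = f} card≤n f-inj x
    with injective⇒onto {g = enum} card≤n f-inj (λ i → index (f i) , ≈enum-index (f i)) (index x)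
  ... | i , e = i , trans (≈enum-index x) e

  ∃∉img : ∀ {m} (g : Fin m → Carrier) → m < card → ∃ λ x → ¬ x ∈img g
  ∃∉img g m<card with Fin.all? (λ j → enum j ∈img? g)
  ... | yes enum⊆g = contradiction (injective⇒≤ enum-injective enum⊆g) (ℕ.<⇒≱ m<card)
  ... | no  enum⊈g = enum (proj₁ j∉) , proj₂ j∉
    where
    j∉ : ∃ λ j → ¬ enum j ∈img g
    j∉ = Fin.¬∀⟶∃¬ card _ (λ j → enum j ∈img? g) enum⊈g

  infixr 8 _·_
  _·_ : ℕ → Carrier → Carrier
  _·_ = _·ₙ_ F

  open MonoidMult +-monoid using (×-congʳ; ×-homo-+; ×-homo-1; ×-assocˡ)
  open CommutativeMonoidMult +-commutativeMonoid using (×-distrib-+)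
  open SemiringMult semiring using (×-comm-*; ×-assoc-*; ×1-homo-*)
  open SemiringSum semiring using (sum; sum-permute; ∑-distrib-+; sum-cong-≋; sum-replicate)
  open GroupProperties +-group using (identityʳ-unique; identityˡ-unique; inverseˡ-unique; inverseʳ-unique; x∙y⁻¹≈ε⇒x≈y)
  open AbelianGroupProperties +-abelianGroup using (⁻¹-∙-comm)
  open RingProperties ring using (x[y-z]≈xy-xz)
  open CommutativeSemigroupProperties +-commutativeSemigroup using (interchange)
  open CommutativeSemigroupProperties *-commutativeSemigroup using () renaming (interchange to *-interchange; xy∙z≈y∙xz to *-xy∙z≈y∙xz)

  -- Translation by 1 permutes F, so Σ x = Σ (x + 1) = Σ x + card · 1.
  card·1≈0 : card · 1# ≈ 0#
  card·1≈0 = identityʳ-unique (sum enum) (card · 1#) (sym (begin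
    sum enum                      ≈⟨ sum-permute enum π ⟩
    sum (enum ∘ succ)             ≈⟨ sum-cong-≋ (λ i → sym (≈enum-index (enum i + 1#))) ⟩
    sum (λ i → enum i + 1#)       ≈⟨ ∑-distrib-+ enum (λ _ → 1#) ⟩
    sum enum + sum {card} (λ _ → 1#) ≈⟨ +-congˡ (sum-replicate card) ⟩
    sum enum + card · 1#          ∎))
    where
    shift : Carrier → Fin card → Fin card
    shift a i = index (enum i + a)
    shift-shift : ∀ a b → a + b ≈ 0# → ∀ i → shift b (shift a i) ≡ i
    shift-shift a b a+b≈0 i = enum-injective (begin
      enum (shift b (shift a i))  ≈⟨ ≈enum-index _ ⟨
      enum (shift a i) + b        ≈⟨ +-congʳ (≈enum-index _) ⟨
      (enum i + a) + b            ≈⟨ +-assoc _ a b ⟩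
      enum i + (a + b)            ≈⟨ +-congˡ a+b≈0 ⟩
      enum i + 0#                 ≈⟨ +-identityʳ _ ⟩
      enum i                      ∎)
    succ : Fin card → Fin card
    succ = shift 1#
    π : Permutation card card
    π = permutation succ (shift (- 1#)) (shift-shift (- 1#) 1# (-‿inverseˡ 1#)) (shift-shift 1# (- 1#) (-‿inverseʳ 1#))

  *-inverse-cancel : ∀ {x x′} → x * x′ ≈ 1# → ∀ z → x′ * (x * z) ≈ z
  *-inverse-cancel {x} {x′} xx′≈1 z = begin
    x′ * (x * z)   ≈⟨ *-assoc x′ x z ⟨
    (x′ * x) * z   ≈⟨ *-congʳ (trans (*-comm x′ x) xx′≈1) ⟩
    1# * z         ≈⟨ *-identityˡ z ⟩
    z              ∎

  *-cancelˡ : ∀ {x y z} → ¬ x ≈ 0# → x * y ≈ x * z → y ≈ z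
  *-cancelˡ {x} {y} {z} x≉0 xy≈xz = begin
    y              ≈⟨ *-inverse-cancel xx′≈1 y ⟨
    x′ * (x * y)   ≈⟨ *-congˡ xy≈xz ⟩
    x′ * (x * z)   ≈⟨ *-inverse-cancel xx′≈1 z ⟩
    z              ∎
    where
    x′ : Carrier
    x′ = proj₁ (inverse x x≉0)
    xx′≈1 : x * x′ ≈ 1#
    xx′≈1 = proj₂ (inverse x x≉0)

  *-≈0ʳ : ∀ {x y} → ¬ x ≈ 0# → x * y ≈ 0# → y ≈ 0#
  *-≈0ʳ {x} x≉0 xy≈0 = *-cancelˡ x≉0 (trans xy≈0 (sym (zeroʳ x)))

  ^·1≈0⇒·1≈0 : ∀ p k → (p ^ k) · 1# ≈ 0# → p · 1# ≈ 0#
  ^·1≈0⇒·1≈0 p zero    1+0≈0 = contradiction (trans (sym (+-identityʳ 1#)) 1+0≈0) 1≉0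
  ^·1≈0⇒·1≈0 p (suc k) p^[1+k]≈0 with p · 1# ≈? 0#
  ... | yes p≈0 = p≈0
  ... | no  p≉0 = ^·1≈0⇒·1≈0 p k (*-≈0ʳ p≉0 (trans (sym (×1-homo-* p (p ^ k))) p^[1+k]≈0))

  card≡p^k⇒p·≈0 : ∀ {p k} → card ≡ p ^ k → ∀ x → p · x ≈ 0#
  card≡p^k⇒p·≈0 {p} {k} card≡p^k x = begin
    p · x          ≈⟨ ×-congʳ p (*-identityˡ x) ⟨
    p · (1# * x)   ≈⟨ ×-assoc-* p 1# x ⟨
    (p · 1#) * x   ≈⟨ *-congʳ p·1≈0 ⟩
    0# * x         ≈⟨ zeroˡ x ⟩
    0#             ∎
    where
    p·1≈0 : p · 1# ≈ 0#
    p·1≈0 = ^·1≈0⇒·1≈0 p k (trans (reflexive (≡.cong (_· 1#) (≡.sym card≡p^k))) card·1≈0)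

  ·-zeroʳ : ∀ n → n · 0# ≈ 0#
  ·-zeroʳ zero    = refl
  ·-zeroʳ (suc n) = trans (+-identityˡ (n · 0#)) (·-zeroʳ n)

  sumFin-cong : ∀ d {f g : Fin d → Carrier} → (∀ t → f t ≈ g t) → sumFin F d f ≈ sumFin F d g
  sumFin-cong zero    f≈g = refl
  sumFin-cong (suc d) f≈g = +-cong (f≈g Fin.zero) (sumFin-cong d (f≈g ∘ Fin.suc))

  sumFin-zero : ∀ d → sumFin F d (λ _ → 0#) ≈ 0#
  sumFin-zero zero    = refl
  sumFin-zero (suc d) = trans (+-identityˡ _) (sumFin-zero d)

  sumFin-+ : ∀ d (f g : Fin d → Carrier) → sumFin F d (λ t → f t + g t) ≈ sumFin F d f + sumFin F d g
  sumFin-+ zero    f g = sym (+-identityʳ 0#)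
  sumFin-+ (suc d) f g = trans (+-congˡ (sumFin-+ d (f ∘ Fin.suc) (g ∘ Fin.suc))) (interchange _ _ _ _)

  ·-sumFin : ∀ d n (f : Fin d → Carrier) → n · sumFin F d f ≈ sumFin F d (λ t → n · f t)
  ·-sumFin zero    n f = ·-zeroʳ n
  ·-sumFin (suc d) n f = trans (×-distrib-+ _ _ n) (+-congˡ (·-sumFin d n (f ∘ Fin.suc)))

  *-sumFin : ∀ d x (f : Fin d → Carrier) → x * sumFin F d f ≈ sumFin F d (λ t → x * f t)
  *-sumFin zero    x f = zeroʳ x
  *-sumFin (suc d) x f = trans (distribˡ x _ _) (+-congˡ (*-sumFin d x (f ∘ Fin.suc)))

  sumFin-closed : ∀ {a} {P : Carrier → Set a} → IsFpSubspace F P →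
                  ∀ d {f : Fin d → Carrier} → (∀ t → P (f t)) → P (sumFin F d f)
  sumFin-closed P-sub zero    Pf = IsFpSubspace.zero∈ P-sub
  sumFin-closed P-sub (suc d) Pf = IsFpSubspace.+-closed P-sub (Pf Fin.zero) (sumFin-closed P-sub d (Pf ∘ Fin.suc))

  linComb : ∀ {d} → (Fin d → ℕ) → Vector Carrier d → Carrier
  linComb {d} k u = sumFin F d (λ t → k t · u t)

  infix 4 _∈⟨_⟩
  _∈⟨_⟩ : ∀ {d} → Carrier → Vector Carrier d → Set ℓ
  x ∈⟨ u ⟩ = ∃ λ k → x ≈ linComb k u

  linComb-head : ∀ {d} (u : Vector Carrier (suc d)) → linComb (1 ∷ λ _ → 0) u ≈ u Fin.zero
  linComb-head {d} u = trans (+-cong (×-homo-1 _) (sumFin-zero d)) (+-identityʳ _)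

  linComb-closed : ∀ {a d} {P : Carrier → Set a} {u : Vector Carrier d} → IsFpSubspace F P →
                   (∀ t → P (u t)) → ∀ k → P (linComb k u)
  linComb-closed {d = d} P-sub Pu k = sumFin-closed P-sub d (λ t → IsFpSubspace.·-closed P-sub (k t) (Pu t))

  ∈⟨⟩-least : ∀ {a d} {P : Carrier → Set a} {u : Vector Carrier d} → IsFpSubspace F P →
              (∀ t → P (u t)) → ∀ {x} → x ∈⟨ u ⟩ → P x
  ∈⟨⟩-least P-sub Pu (k , x≈ku) = IsFpSubspace.resp P-sub (sym x≈ku) (linComb-closed P-sub Pu k)

  ∈⟨⟩-subspace : ∀ {d} {u : Vector Carrier d} → IsFpSubspace F (_∈⟨ u ⟩)
  ∈⟨⟩-subspace {d} {u} = record
    { resp     = λ { x≈y (k , x≈ku) → k , trans (sym x≈y) x≈ku }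
    ; zero∈    = (λ _ → 0) , sym (sumFin-zero d)
    ; +-closed = λ { (k , x≈ku) (l , y≈lu) → (λ t → k t ℕ.+ l t) , (begin
        _ + _                                  ≈⟨ +-cong x≈ku y≈lu ⟩
        linComb k u + linComb l u              ≈⟨ sumFin-+ d _ _ ⟨
        sumFin F d (λ t → k t · u t + l t · u t) ≈⟨ sumFin-cong d (λ t → ×-homo-+ (u t) (k t) (l t)) ⟨
        linComb (λ t → k t ℕ.+ l t) u          ∎) }
    ; ·-closed = λ { n (k , x≈ku) → (λ t → n ℕ.* k t) , (begin
        n · _                                  ≈⟨ ×-congʳ n x≈ku ⟩
        n · linComb k u                        ≈⟨ ·-sumFin d n _ ⟩
        sumFin F d (λ t → n · (k t · u t))     ≈⟨ sumFin-cong d (λ t → ×-assocˡ (u t) n (k t)) ⟩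
        linComb (λ t → n ℕ.* k t) u            ∎) }
    }

  ∈⟨⟩⇒Span : ∀ {a d} {X : Carrier → Set a} {u : Vector Carrier d} → (∀ t → X (u t)) →
              ∀ {x} → x ∈⟨ u ⟩ → Span F X x
  ∈⟨⟩⇒Span {d = zero}      Xu (k , x≈0)   = List.[] , All.[] , x≈0
  ∈⟨⟩⇒Span {d = suc d} {u = u} Xu (k , x≈ku) with ∈⟨⟩⇒Span (Xu ∘ Fin.suc) (k ∘ Fin.suc , refl)
  ... | ts , Xts , ≈ts = (k Fin.zero , u Fin.zero) List.∷ ts , Xu Fin.zero All.∷ Xts , trans x≈ku (+-congˡ ≈ts)

  Stabilizer : ∀ {a} → (Carrier → Set a) → Carrier → Set (c ⊔ a)
  Stabilizer P x = ∀ {y} → P y → P (x * y)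

  module _ {a} {P : Carrier → Set a} (P-sub : IsFpSubspace F P) where
    open IsFpSubspace P-sub

    *-preimage-subspace : ∀ x → IsFpSubspace F (λ y → P (x * y))
    *-preimage-subspace x = record
      { resp     = λ y≈z → resp (*-congˡ y≈z)
      ; zero∈    = resp (sym (zeroʳ x)) zero∈
      ; +-closed = λ Pxy Pxz → resp (sym (distribˡ x _ _)) (+-closed Pxy Pxz)
      ; ·-closed = λ n Pxy → resp (sym (×-comm-* n x _)) (·-closed n Pxy)
      }

    Stabilizer-subspace : IsFpSubspace F (Stabilizer P)
    Stabilizer-subspace = record
      { resp     = λ x≈z Sx Py → resp (*-congʳ x≈z) (Sx Py)
      ; zero∈    = λ {y} _ → resp (sym (zeroˡ y)) zero∈
      ; +-closed = λ {x} {z} Sx Sz {y} Py → resp (sym (distribʳ y x z)) (+-closed (Sx Py) (Sz Py))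
      ; ·-closed = λ n {x} Sx {y} Py → resp (sym (×-assoc-* n x y)) (·-closed n (Sx Py))
      }

  Stabilizer-∈⟨⟩ : ∀ {d} {b : Vector Carrier d} {x} → (∀ t → x * b t ∈⟨ b ⟩) → Stabilizer (_∈⟨ b ⟩) x
  Stabilizer-∈⟨⟩ xb∈ = ∈⟨⟩-least (*-preimage-subspace ∈⟨⟩-subspace _) xb∈

  [a+r]-[a+s]≈r-s : ∀ a r s → (a + r) - (a + s) ≈ r - s
  [a+r]-[a+s]≈r-s a r s = begin
    (a + r) - (a + s)       ≈⟨ +-congˡ (⁻¹-∙-comm a s) ⟨
    (a + r) + (- a - s)     ≈⟨ interchange a r (- a) (- s) ⟩
    (a - a) + (r - s)       ≈⟨ +-congʳ (-‿inverseʳ a) ⟩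
    0# + (r - s)            ≈⟨ +-identityˡ (r - s) ⟩
    r - s                   ∎

  module Characteristic {p} (p-prime : Prime p) (char : ∀ x → p · x ≈ 0#) where
    private instance
      p-nonZero : NonZero p
      p-nonZero = prime⇒nonZero p-prime

    ·-mod : ∀ k x → k · x ≈ (k % p) · x
    ·-mod k x = begin
      k · x                                ≡⟨ ≡.cong (_· x) (m≡m%n+[m/n]*n k p) ⟩
      (k % p ℕ.+ (k / p) ℕ.* p) · x        ≈⟨ ×-homo-+ x (k % p) _ ⟩
      (k % p) · x + ((k / p) ℕ.* p) · x    ≈⟨ +-congˡ (×-assocˡ x (k / p) p) ⟨
      (k % p) · x + (k / p) · (p · x)      ≈⟨ +-congˡ (trans (×-congʳ (k / p) (char x)) (·-zeroʳ (k / p))) ⟩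
      (k % p) · x + 0#                     ≈⟨ +-identityʳ _ ⟩
      (k % p) · x                          ∎

    %-·-cong : ∀ {k l} → k % p ≡ l % p → ∀ x → k · x ≈ l · x
    %-·-cong {k} {l} k≡l x = trans (·-mod k x) (trans (reflexive (≡.cong (_· x) k≡l)) (sym (·-mod l x)))

    -≈pred· : ∀ x → - x ≈ pred p · x
    -≈pred· x = sym (inverseʳ-unique x (pred p · x) (begin
      x + pred p · x     ≡⟨⟩
      suc (pred p) · x   ≡⟨ ≡.cong (_· x) (suc-pred p) ⟩
      p · x              ≈⟨ char x ⟩
      0#                 ∎))

    module _ {a} {P : Carrier → Set a} (P-sub : IsFpSubspace F P) where
      open IsFpSubspace P-sub

      -‿closed : ∀ {x} → P x → P (- x)
      -‿closed {x} Px = resp (sym (-≈pred· x)) (·-closed (pred p) Px)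

      coprime-·-reflects : ∀ {k x} → Coprime p k → P (k · x) → P x
      coprime-·-reflects {k} {x} p⊥k Pkx with coprime-Bézout p⊥k
      ... | Bézout.+- s t 1+tk≡sp = resp (sym x≈-tkx) (-‿closed (·-closed t Pkx))
        where
        x≈-tkx : x ≈ - (t · k · x)
        x≈-tkx = inverseˡ-unique x (t · k · x) (begin
          x + t · k · x        ≈⟨ +-congˡ (×-assocˡ x t k) ⟩
          suc (t ℕ.* k) · x    ≡⟨ ≡.cong (_· x) 1+tk≡sp ⟩
          (s ℕ.* p) · x        ≈⟨ ×-assocˡ x s p ⟨
          s · p · x            ≈⟨ ×-congʳ s (char x) ⟩
          s · 0#               ≈⟨ ·-zeroʳ s ⟩
          0#                   ∎)
      ... | Bézout.-+ s t 1+sp≡tk = resp (sym x≈tkx) (·-closed t Pkx)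
        where
        x≈tkx : x ≈ t · k · x
        x≈tkx = begin
          x                    ≈⟨ +-identityʳ x ⟨
          x + 0#               ≈⟨ +-congˡ (trans (×-congʳ s (char x)) (·-zeroʳ s)) ⟨
          x + s · p · x        ≈⟨ +-congˡ (×-assocˡ x s p) ⟩
          suc (s ℕ.* p) · x    ≡⟨ ≡.cong (_· x) 1+sp≡tk ⟩
          (t ℕ.* k) · x        ≈⟨ ×-assocˡ x t k ⟨
          t · k · x            ∎

    digits : ∀ d → Fin (p ^ d) → Vector (Fin p) d
    digits zero    i = []
    digits (suc d) i = proj₁ (Fin.remQuot {p} (p ^ d) i) ∷ digits d (proj₂ (Fin.remQuot {p} (p ^ d) i))

    undigits : ∀ d → Vector (Fin p) d → Fin (p ^ d)
    undigits zero    r = Fin.zero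
    undigits (suc d) r = Fin.combine (r Fin.zero) (undigits d (r ∘ Fin.suc))

    digits-undigits : ∀ d r t → digits d (undigits d r) t ≡ r t
    digits-undigits (suc d) r Fin.zero    = ≡.cong proj₁ (Fin.remQuot-combine (r Fin.zero) _)
    digits-undigits (suc d) r (Fin.suc t) =
      ≡.trans (≡.cong (λ q → digits d (proj₂ q) t) (Fin.remQuot-combine (r Fin.zero) _))
        (digits-undigits d (r ∘ Fin.suc) t)

    digits-injective : ∀ d {i j} → (∀ t → digits d i t ≡ digits d j t) → i ≡ j
    digits-injective zero    {Fin.zero} {Fin.zero} _ = ≡.refl
    digits-injective (suc d) {i} {j} i≗j =
      ≡.trans (≡.sym (Fin.combine-remQuot {p} (p ^ d) i))
        (≡.trans (≡.cong₂ Fin.combine (i≗j Fin.zero) (digits-injective d (i≗j ∘ Fin.suc)))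
          (Fin.combine-remQuot {p} (p ^ d) j))

    combination : ∀ {d} → Vector Carrier d → Fin (p ^ d) → Carrier
    combination {d} u i = linComb (toℕ ∘ digits d i) u

    combination-∈⟨⟩ : ∀ {d} (u : Vector Carrier d) i → combination u i ∈⟨ u ⟩
    combination-∈⟨⟩ {d} u i = toℕ ∘ digits d i , refl

    ∈⟨⟩⇒∈img : ∀ {d} {u : Vector Carrier d} {x} → x ∈⟨ u ⟩ → x ∈img combination u
    ∈⟨⟩⇒∈img {d} {u} {x} (k , x≈ku) = undigits d r , trans x≈ku (sumFin-cong d λ t → begin
      k t · u t                                   ≈⟨ ·-mod (k t) (u t) ⟩
      (k t % p) · u t                             ≡⟨ ≡.cong (_· u t) (Fin.toℕ-fromℕ< (m%n<n (k t) p)) ⟨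
      toℕ (r t) · u t                             ≡⟨ ≡.cong (λ i → toℕ i · u t) (digits-undigits d r t) ⟨
      toℕ (digits d (undigits d r) t) · u t       ∎)
      where
      r : Vector (Fin p) d
      r t = Fin.fromℕ< (m%n<n (k t) p)

    infix 4 _∈⟨_⟩?
    _∈⟨_⟩? : ∀ {d} x (u : Vector Carrier d) → Dec (x ∈⟨ u ⟩)
    x ∈⟨ u ⟩? = Dec.map′ (λ { (i , x≈ui) → toℕ ∘ digits _ i , x≈ui }) ∈⟨⟩⇒∈img (x ∈img? combination u)

    LinearlyIndependent : ∀ {d} → Vector Carrier d → Set ℓ
    LinearlyIndependent {d} u = ∀ (k : Fin d → ℕ) → (∀ t → k t < p) → linComb k u ≈ 0# → ∀ t → k t ≡ 0

    private
      1<p : 1 < p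
      1<p = ℕ.nonTrivial⇒n>1 p {{prime⇒nonTrivial p-prime}}

      p<p^[2+n] : ∀ n → p < p ^ suc (suc n)
      p<p^[2+n] n = ≡.subst (_< p ^ suc (suc n)) (ℕ.*-identityʳ p) (ℕ.^-monoʳ-< p 1<p {1} {suc (suc n)} (s≤s z<s))

      b≤p+a : ∀ {a b} → b < p → b ≤ p ℕ.+ a
      b≤p+a {a} b<p = ℕ.≤-trans (ℕ.<⇒≤ b<p) (ℕ.m≤m+n p a)

    -- For a, b < p, a ⊖ b is the residue of a − b modulo p.
    _⊖_ : ℕ → ℕ → ℕ
    a ⊖ b with b ℕ.≤? a
    ... | yes _ = a ∸ b
    ... | no  _ = p ℕ.+ a ∸ b

    ⊖<p : ∀ {a b} → a < p → b < p → a ⊖ b < p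
    ⊖<p {a} {b} a<p b<p with b ℕ.≤? a
    ... | yes _   = ℕ.≤-<-trans (ℕ.m∸n≤m a b) a<p
    ... | no  b≰a = ℕ.<-≤-trans (ℕ.∸-monoˡ-< (ℕ.+-monoʳ-< p (ℕ.≰⇒> b≰a)) (b≤p+a b<p))
                                (ℕ.≤-reflexive (ℕ.m+n∸n≡m p b))

    ⊖≡0⇒≡ : ∀ {a b} → b < p → a ⊖ b ≡ 0 → a ≡ b
    ⊖≡0⇒≡ {a} {b} b<p a⊖b≡0 with b ℕ.≤? a
    ... | yes b≤a = ℕ.≤-antisym (ℕ.m∸n≡0⇒m≤n a⊖b≡0) b≤a
    ... | no  _   = contradiction (ℕ.≤-trans (ℕ.m≤m+n p a) (ℕ.m∸n≡0⇒m≤n a⊖b≡0)) (ℕ.<⇒≱ b<p)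

    ⊖-·-+ : ∀ a {b} → b < p → ∀ x → (a ⊖ b) · x + b · x ≈ a · x
    ⊖-·-+ a {b} b<p x with b ℕ.≤? a
    ... | yes b≤a = begin
      (a ∸ b) · x + b · x        ≈⟨ ×-homo-+ x (a ∸ b) b ⟨
      (a ∸ b ℕ.+ b) · x          ≡⟨ ≡.cong (_· x) (ℕ.m∸n+n≡m b≤a) ⟩
      a · x                      ∎
    ... | no  _   = begin
      (p ℕ.+ a ∸ b) · x + b · x  ≈⟨ ×-homo-+ x (p ℕ.+ a ∸ b) b ⟨
      (p ℕ.+ a ∸ b ℕ.+ b) · x    ≡⟨ ≡.cong (_· x) (ℕ.m∸n+n≡m (b≤p+a b<p)) ⟩
      (p ℕ.+ a) · x              ≈⟨ ×-homo-+ x p a ⟩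
      p · x + a · x              ≈⟨ +-congʳ (char x) ⟩
      0# + a · x                 ≈⟨ +-identityˡ (a · x) ⟩
      a · x                      ∎

    combination-injective : ∀ {d} {u : Vector Carrier d} → LinearlyIndependent u → Injective _≡_ _≈_ (combination u)
    combination-injective {d} {u} u-ind {i} {j} ui≈uj =
      digits-injective d λ t → Fin.toℕ-injective (⊖≡0⇒≡ (b<p t) (u-ind k (λ t → ⊖<p (a<p t) (b<p t)) Σk≈0 t))
      where
      a b k : Fin d → ℕ
      a = toℕ ∘ digits d i
      b = toℕ ∘ digits d j
      k t = a t ⊖ b t
      a<p b<p : ∀ t → _ < p
      a<p t = Fin.toℕ<n (digits d i t)
      b<p t = Fin.toℕ<n (digits d j t)
      Σk≈0 : linComb k u ≈ 0#
      Σk≈0 = identityˡ-unique (linComb k u) (linComb b u) (begin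
        linComb k u + linComb b u               ≈⟨ sumFin-+ d _ _ ⟨
        sumFin F d (λ t → k t · u t + b t · u t) ≈⟨ sumFin-cong d (λ t → ⊖-·-+ (a t) (b<p t) (u t)) ⟩
        combination u i                         ≈⟨ ui≈uj ⟩
        combination u j                         ∎)

    independent-∷ : ∀ {d} {u : Vector Carrier d} {w} → LinearlyIndependent u → ¬ w ∈⟨ u ⟩ →
                    LinearlyIndependent (w ∷ u)
    independent-∷ {u = u} {w} u-ind w∉ k k<p kw+Σ≈0 with k Fin.zero ℕ.≟ 0
    ... | yes k₀≡0 = λ where
      Fin.zero    → k₀≡0
      (Fin.suc t) → u-ind (k ∘ Fin.suc) (k<p ∘ Fin.suc) (begin
        linComb (k ∘ Fin.suc) u             ≈⟨ +-identityˡ _ ⟨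
        0# + linComb (k ∘ Fin.suc) u        ≡⟨ ≡.cong (λ k₀ → k₀ · w + linComb (k ∘ Fin.suc) u) k₀≡0 ⟨
        linComb k (w ∷ u)                   ≈⟨ kw+Σ≈0 ⟩
        0#                                  ∎) t
    ... | no  k₀≢0 = contradiction (coprime-·-reflects ∈⟨⟩-subspace p⊥k₀ k₀w∈) w∉
      where
      p⊥k₀ : Coprime p (k Fin.zero)
      p⊥k₀ = prime⇒coprime p-prime {{ℕ.≢-nonZero k₀≢0}} (k<p Fin.zero)
      k₀w∈ : k Fin.zero · w ∈⟨ u ⟩
      k₀w∈ = IsFpSubspace.resp ∈⟨⟩-subspace (sym (inverseˡ-unique _ _ kw+Σ≈0))
               (-‿closed ∈⟨⟩-subspace (k ∘ Fin.suc , refl))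

    independent-scale : ∀ {d} {u : Vector Carrier d} {a} → ¬ a ≈ 0# → LinearlyIndependent u →
                        LinearlyIndependent (map (a *_) u)
    independent-scale {d} {u} {a} a≉0 u-ind k k<p Σ≈0 = u-ind k k<p (*-≈0ʳ a≉0 (begin
      a * linComb k u                        ≈⟨ *-sumFin d a _ ⟩
      sumFin F d (λ t → a * (k t · u t))     ≈⟨ sumFin-cong d (λ t → ×-comm-* (k t) a (u t)) ⟩
      linComb k (map (a *_) u)               ≈⟨ Σ≈0 ⟩
      0#                                     ∎))

    independent⇒head≉0 : ∀ {d} {u : Vector Carrier (suc d)} → LinearlyIndependent u → ¬ u Fin.zero ≈ 0#
    independent⇒head≉0 {d} {u} u-ind u₀≈0 =
      contradiction (u-ind _ k<p (trans (linComb-head u) u₀≈0) Fin.zero) λ ()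
      where
      k<p : ∀ t → (1 ∷ λ _ → 0) t < p
      k<p Fin.zero    = 1<p
      k<p (Fin.suc _) = ℕ.>-nonZero⁻¹ p

    ∷-spans : ∀ {n} {u : Vector Carrier n} {w} → card ≡ p ^ suc n → LinearlyIndependent u →
              ¬ w ∈⟨ u ⟩ → ∀ z → z ∈⟨ w ∷ u ⟩
    ∷-spans {n} {u} {w} card≡ u-ind w∉ z
      with injective⇒surjective (ℕ.≤-reflexive card≡) (combination-injective {u = w ∷ u} (independent-∷ u-ind w∉)) z
    ... | i , z≈ = toℕ ∘ digits (suc n) i , z≈

    ∃∉⟨⟩ : ∀ {d} (u : Vector Carrier d) → p ^ d < card → ∃ λ x → ¬ x ∈⟨ u ⟩
    ∃∉⟨⟩ u p^d<card with ∃∉img (combination u) p^d<card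
    ... | x , x∉ = x , x∉ ∘ ∈⟨⟩⇒∈img

    Stabilizer-⁻¹ : ∀ {d} {b : Vector Carrier d} {x y} → LinearlyIndependent b → x * y ≈ 1# →
                    Stabilizer (_∈⟨ b ⟩) x → Stabilizer (_∈⟨ b ⟩) y
    Stabilizer-⁻¹ {d} {b} {x} {y} b-ind xy≈1 x-stab {z} z∈ =
      IsFpSubspace.resp ∈⟨⟩-subspace (sym (begin
        y * z                          ≈⟨ *-congˡ (trans (proj₂ z∈b) (proj₂ bj∈xb)) ⟩
        y * (x * combination b i)      ≈⟨ *-inverse-cancel xy≈1 _ ⟩
        combination b i                ∎)) (combination-∈⟨⟩ b i)
      where
      x≉0 : ¬ x ≈ 0#
      x≉0 x≈0 = 1≉0 (trans (sym xy≈1) (trans (*-congʳ x≈0) (zeroˡ y)))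
      x*b-injective : Injective _≡_ _≈_ (λ i → x * combination b i)
      x*b-injective = combination-injective b-ind ∘ *-cancelˡ x≉0
      x*b⊆b : ∀ i → x * combination b i ∈img combination b
      x*b⊆b i = ∈⟨⟩⇒∈img (x-stab (combination-∈⟨⟩ b i))
      z∈b : z ∈img combination b
      z∈b = ∈⟨⟩⇒∈img z∈
      bj∈xb : combination b (proj₁ z∈b) ∈img (λ i → x * combination b i)
      bj∈xb = injective⇒onto ℕ.≤-refl x*b-injective x*b⊆b (proj₁ z∈b)
      i : Fin (p ^ d)
      i = proj₁ bj∈xb

    multiple-meets-hyperplane : ∀ {n} {c : Vector Carrier n} {y} → card ≡ p ^ suc n → p < p ^ n →
                                LinearlyIndependent c → ¬ y ∈⟨ c ⟩ →
                                ∃ λ x → x ∈⟨ c ⟩ × ¬ x ≈ 0# × y * x ∈⟨ c ⟩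
    multiple-meets-hyperplane {n} {c} {y} card≡ p<p^n c-ind y∉ = cᵢ - cⱼ , x∈ , x≉0 , yx∈
      where
      open IsFpSubspace ∈⟨⟩-subspace
      y*c∈⟨y∷c⟩ : ∀ i → y * combination c i ∈⟨ y ∷ c ⟩
      y*c∈⟨y∷c⟩ i = ∷-spans card≡ c-ind y∉ (y * combination c i)
      coeff : Fin (p ^ n) → Fin (suc n) → ℕ
      coeff i = proj₁ (y*c∈⟨y∷c⟩ i)
      rest : Fin (p ^ n) → Carrier
      rest i = linComb (coeff i ∘ Fin.suc) c
      residue : Fin (p ^ n) → Fin p
      residue i = Fin.fromℕ< (m%n<n (coeff i Fin.zero) p)
      collision : ∃ λ i → ∃ λ j → i Fin.< j × residue i ≡ residue j
      collision = Fin.pigeonhole p<p^n residue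
      i j : Fin (p ^ n)
      i = proj₁ collision
      j = proj₁ (proj₂ collision)
      cᵢ cⱼ : Carrier
      cᵢ = combination c i
      cⱼ = combination c j
      x∈ : cᵢ - cⱼ ∈⟨ c ⟩
      x∈ = +-closed (combination-∈⟨⟩ c i) (-‿closed ∈⟨⟩-subspace (combination-∈⟨⟩ c j))
      x≉0 : ¬ cᵢ - cⱼ ≈ 0#
      x≉0 = Fin.<⇒≢ (proj₁ (proj₂ (proj₂ collision))) ∘ combination-injective c-ind ∘ x∙y⁻¹≈ε⇒x≈y cᵢ cⱼ
      same-y : coeff i Fin.zero · y ≈ coeff j Fin.zero · y
      same-y = %-·-cong (≡.trans (≡.sym (Fin.toℕ-fromℕ< _))
                          (≡.trans (≡.cong toℕ (proj₂ (proj₂ (proj₂ collision)))) (Fin.toℕ-fromℕ< _))) y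
      yx∈ : y * (cᵢ - cⱼ) ∈⟨ c ⟩
      yx∈ = resp (sym (begin
        y * (cᵢ - cⱼ)                                        ≈⟨ x[y-z]≈xy-xz y cᵢ cⱼ ⟩
        y * cᵢ - y * cⱼ                                      ≈⟨ +-cong (proj₂ (y*c∈⟨y∷c⟩ i)) (-‿cong (proj₂ (y*c∈⟨y∷c⟩ j))) ⟩
        (coeff i Fin.zero · y + rest i) - (coeff j Fin.zero · y + rest j) ≈⟨ +-congˡ (-‿cong (+-congʳ same-y)) ⟨
        (coeff i Fin.zero · y + rest i) - (coeff i Fin.zero · y + rest j) ≈⟨ [a+r]-[a+s]≈r-s _ (rest i) (rest j) ⟩
        rest i - rest j                                      ∎))
        (+-closed (coeff i ∘ Fin.suc , refl) (-‿closed ∈⟨⟩-subspace (coeff j ∘ Fin.suc , refl)))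

    ∃∉Stabilizer : ∀ {n} {b : Vector Carrier (suc n)} → card ≡ p ^ suc (suc n) → LinearlyIndependent b →
                   ∃ λ y → ¬ Stabilizer (_∈⟨ b ⟩) y
    ∃∉Stabilizer {n} {b} card≡ b-ind
      with ∃∉⟨⟩ b (ℕ.<-≤-trans (ℕ.^-monoʳ-< p 1<p (ℕ.n<1+n (suc n))) (ℕ.≤-reflexive (≡.sym card≡)))
    ... | x , x∉b = x * b₀′ , λ y-stab → x∉b (IsFpSubspace.resp (∈⟨⟩-subspace {u = b}) (begin
      (x * b₀′) * b₀   ≈⟨ *-assoc x b₀′ b₀ ⟩
      x * (b₀′ * b₀)   ≈⟨ *-congˡ (trans (*-comm b₀′ b₀) (proj₂ (inverse b₀ b₀≉0))) ⟩
      x * 1#           ≈⟨ *-identityʳ x ⟩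
      x                ∎) (y-stab ((1 ∷ λ _ → 0) , sym (linComb-head b))))
      where
      b₀ b₀′ : Carrier
      b₀ = b Fin.zero
      b₀≉0 : ¬ b₀ ≈ 0#
      b₀≉0 = independent⇒head≉0 {u = b} b-ind
      b₀′ = proj₁ (inverse b₀ b₀≉0)

    hyperplane-not-stable : ∀ {n} {c b : Vector Carrier n} → 2 ≤ n → card ≡ p ^ suc n →
                            LinearlyIndependent c → LinearlyIndependent b →
                            ¬ (∀ s → Stabilizer (_∈⟨ b ⟩) (c s))
    hyperplane-not-stable {suc (suc n)} {c} {b} (s≤s (s≤s _)) card≡ c-ind b-ind c-stab =
      y∉stab (y∈stab (multiple-meets-hyperplane {c = c} card≡ (p<p^[2+n] n) c-ind (y∉stab ∘ ⟨c⟩⊆stab)))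
      where
      ⟨c⟩⊆stab : ∀ {z} → z ∈⟨ c ⟩ → Stabilizer (_∈⟨ b ⟩) z
      ⟨c⟩⊆stab = ∈⟨⟩-least (Stabilizer-subspace (∈⟨⟩-subspace {u = b})) c-stab
      y : Carrier
      y = proj₁ (∃∉Stabilizer {b = b} card≡ b-ind)
      y∉stab : ¬ Stabilizer (_∈⟨ b ⟩) y
      y∉stab = proj₂ (∃∉Stabilizer {b = b} card≡ b-ind)
      y∈stab : (∃ λ d → d ∈⟨ c ⟩ × ¬ d ≈ 0# × y * d ∈⟨ c ⟩) → Stabilizer (_∈⟨ b ⟩) y
      y∈stab (d , d∈c , d≉0 , yd∈c) {z} z∈b = IsFpSubspace.resp (∈⟨⟩-subspace {u = b}) (begin
        d′ * ((y * d) * z)    ≈⟨ *-congˡ (*-xy∙z≈y∙xz y d z) ⟩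
        d′ * (d * (y * z))    ≈⟨ *-inverse-cancel dd′≈1 (y * z) ⟩
        y * z                 ∎)
        (Stabilizer-⁻¹ {b = b} b-ind dd′≈1 (⟨c⟩⊆stab d∈c) (⟨c⟩⊆stab yd∈c z∈b))
        where
        d′ : Carrier
        d′ = proj₁ (inverse d d≉0)
        dd′≈1 : d * d′ ≈ 1#
        dd′≈1 = proj₂ (inverse d d≉0)

    scaled-products-⊈ : ∀ {n} {a b : Vector Carrier n} {a₀} → 2 ≤ n → card ≡ p ^ suc n →
                        LinearlyIndependent a → LinearlyIndependent b → ¬ a₀ ≈ 0# →
                        ¬ (∀ s j → a s * b j ∈⟨ map (a₀ *_) b ⟩)
    scaled-products-⊈ {a = a} {b} {a₀} 2≤n card≡ a-ind b-ind a₀≉0 ab⊆a₀b =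
      hyperplane-not-stable 2≤n card≡ (independent-scale a₀′≉0 a-ind) (independent-scale a₀≉0 b-ind)
        λ s → Stabilizer-∈⟨⟩ λ j → IsFpSubspace.resp ∈⟨⟩-subspace (sym (begin
          (a₀′ * a s) * (a₀ * b j)   ≈⟨ *-interchange a₀′ (a s) a₀ (b j) ⟩
          (a₀′ * a₀) * (a s * b j)   ≈⟨ *-congʳ (trans (*-comm a₀′ a₀) a₀a₀′≈1) ⟩
          1# * (a s * b j)           ≈⟨ *-identityˡ _ ⟩
          a s * b j                  ∎)) (ab⊆a₀b s j)
      where
      a₀′ : Carrier
      a₀′ = proj₁ (inverse a₀ a₀≉0)
      a₀a₀′≈1 : a₀ * a₀′ ≈ 1#
      a₀a₀′≈1 = proj₂ (inverse a₀ a₀≉0)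
      a₀′≉0 : ¬ a₀′ ≈ 0#
      a₀′≉0 a₀′≈0 = 1≉0 (trans (sym a₀a₀′≈1) (trans (*-congˡ a₀′≈0) (zeroʳ a₀)))

    spanning-products : ∀ {n} {a b : Vector Carrier n} {a₀} → 2 ≤ n → card ≡ p ^ suc n →
                        LinearlyIndependent a → LinearlyIndependent b → ¬ a₀ ≈ 0# →
                        ∃ λ i → ∃ λ j → ∀ z → z ∈⟨ (a i * b j) ∷ map (a₀ *_) b ⟩
    spanning-products {n} {a} {b} {a₀} 2≤n card≡ a-ind b-ind a₀≉0
      with Fin.all? (λ s → Fin.all? λ j → a s * b j ∈⟨ map (a₀ *_) b ⟩?)
    ... | yes ab⊆a₀b = contradiction ab⊆a₀b (scaled-products-⊈ 2≤n card≡ a-ind b-ind a₀≉0)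
    ... | no  ab⊈a₀b with Fin.¬∀⟶∃¬ n _ (λ s → Fin.all? λ j → a s * b j ∈⟨ map (a₀ *_) b ⟩?) ab⊈a₀b
    ... | i , abᵢ⊈a₀b with Fin.¬∀⟶∃¬ n _ (λ j → a i * b j ∈⟨ map (a₀ *_) b ⟩?) abᵢ⊈a₀b
    ... | j , abᵢⱼ∉a₀b = i , j , ∷-spans card≡ (independent-scale a₀≉0 b-ind) abᵢⱼ∉a₀b

    ·ₛ-spans : ∀ {a b n} {X : Carrier → Set a} {Y : Carrier → Set b} {u v : Vector Carrier n} →
               2 ≤ n → card ≡ p ^ suc n → LinearlyIndependent u → LinearlyIndependent v →
               (∀ t → X (u t)) → (∀ t → Y (v t)) → ∀ z → Span F (_·ₛ_ F X Y) z
    ·ₛ-spans {u = u} {v} 2≤n@(s≤s (s≤s _)) card≡ u-ind v-ind Xu Yv z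
      with spanning-products 2≤n card≡ u-ind v-ind (independent⇒head≉0 {u = u} u-ind)
    ... | i , j , spans = ∈⟨⟩⇒Span products (spans z)
      where
      products : ∀ t → _·ₛ_ F _ _ (((u i * v j) ∷ map (u Fin.zero *_) v) t)
      products Fin.zero    = u i , v j , Xu i , Yv j , refl
      products (Fin.suc t) = u Fin.zero , v t , Xu Fin.zero , Yv t , refl

lemma3p7 : ∀ {c ℓ a} (p m : ℕ) → Prime p → m > 2 →
    (F : FiniteField c ℓ) → FiniteField.card F ≡ p ^ m →
    (A B : FiniteField.Carrier F → Set a) →
    IsFpSubspace F A → HasFpDim F p A (m ∸ 1) →
    IsFpSubspace F B → HasFpDim F p B (m ∸ 1) →
    (∀ z → Span F (_·ₛ_ F A A) z) × (∀ z → Span F (_·ₛ_ F A B) z)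
-- Only the bases matter: products of two independent families of size m − 1 already span F.
lemma3p7 p m p-prime (s≤s (s≤s (s≤s _))) F card≡ A B _ (a , a-basis) _ (b , b-basis) =
  ·ₛ-spans 2≤m∸1 card≡ (independent a-basis) (independent a-basis) (inA a-basis) (inA a-basis) ,
  ·ₛ-spans 2≤m∸1 card≡ (independent a-basis) (independent b-basis) (inA a-basis) (inA b-basis)
  where
  open FiniteFieldTheory F
  open Characteristic {p} p-prime (card≡p^k⇒p·≈0 {p} {m} card≡)
  open IsFpBasis
  2≤m∸1 : 2 ≤ m ∸ 1
  2≤m∸1 = s≤s (s≤s z≤n)
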